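{- Let $n\ge 4$ be even. A vertex $v\in V_n$ of the Goldbach factorization graph $F_n$ induces a disconnected component of $F_n$ (i.e. $v$ has no incoming or outgoing arcs other than possibly the loop $(v,v)$) if and only if $v^e=n-v$ for some integer $e\ge 1$.
   Context: For an even integer $n\ge 4$, the Goldbach factorization graph is the directed weighted graph $F_n=(V_n,A_n,w_n)$ with vertex set $V_n=[2,n-2]\cap\mathbb{P}$ ($\mathbb{P}$ the set of primes), arc set $A_n=\{(s,t)\in V_n^2 : s \mid (n-t)\}$ (loops allowed), and weights $w_n((s,t))=\max\{e\ge 1: s^e\mid (n-t)\}$. -}

module Defs where

open import Data.Nat using (ℕ; _∸_; _≤_)
open import Data.Nat.Divisibility using (_∣_)
open import Data.Nat.Primality using (Prime)
open import Data.Product using (_×_)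
open import Relation.Binary.PropositionalEquality using (_≡_)
open import Relation.Nullary using (¬_)

IsVertex : ℕ → ℕ → Set
IsVertex n v = Prime v × 2 ≤ v × v ≤ n ∸ 2

-- Arc set A_n: (s,t) ∈ V_n² with s ∣ (n - t)  (loops allowed)
-- (for t ≤ n-2, truncated subtraction n ∸ t equals n - t)
IsArc : ℕ → ℕ → ℕ → Set
IsArc n s t = IsVertex n s × IsVertex n t × s ∣ (n ∸ t)

Isolated : ℕ → ℕ → Set
Isolated n v = ∀ u → ¬ (u ≡ v) → ¬ IsArc n u v × ¬ IsArc n v u

{-# OPTIONS --safe #-}
-- Every prime divisor p of n − v is a vertex with an arc (p, v), so v can only be isolated
-- if v is the sole prime divisor of n − v, i.e. n − v is a power of v. Conversely, if
-- n − v = vᵉ with e ≥ 1, then a prime u dividing n − v equals v; and v ∣ n, so an arc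
-- (v, u) gives v ∣ n − u, hence v ∣ u and u = v.
module Submission where

open import Defs
open import Data.Nat using (ℕ; zero; suc; _∸_; _≤_; _<_; _^_; _*_; s≤s; z≤n; >-nonZero; nonTrivial⇒n>1; nonTrivial⇒≢1)
open import Data.Nat.Properties using (_≟_; ≤-trans; <⇒≤; ∸-monoʳ-≤; m∸n≤m; m∸n+n≡m; m∸[m∸n]≡n; <-irrefl)
open import Data.Nat.Divisibility using (_∣_; ∣-refl; ∣⇒≤; ∣1⇒≡1; m∣m*n; ∣n⇒∣m*n; ∣m+n∣m⇒∣n; ∣m∸n∣n⇒∣m)
open import Data.Nat.Primality using (Prime; prime⇒nonTrivial; prime⇒irreducible; euclidsLemma)
open import Data.Nat.Primality.Factorisation using (PrimeFactorisation; factorise)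
open import Data.Nat.ListAction using (product)
open import Data.List using ([]; _∷_; length)
open import Data.List.Relation.Unary.All using (All; []; _∷_)
open import Data.Product using (_×_; ∃-syntax; _,_; proj₁)
open import Data.Sum using (inj₁; inj₂)
open import Function.Bundles using (_⇔_; mk⇔)
open import Relation.Nullary using (yes; no; contradiction)
open import Relation.Binary.PropositionalEquality using (_≡_; _≢_; refl; sym; trans; cong₂; subst)

prime⇒2≤ : ∀ {p} → Prime p → 2 ≤ p
prime⇒2≤ {p} pp = nonTrivial⇒n>1 p {{prime⇒nonTrivial pp}}

prime⇒≢1 : ∀ {p} → Prime p → p ≢ 1
prime⇒≢1 pp = nonTrivial⇒≢1 {{prime⇒nonTrivial pp}}

prime∣prime⇒≡ : ∀ {p q} → Prime p → Prime q → p ∣ q → p ≡ q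
prime∣prime⇒≡ pp pq p∣q with prime⇒irreducible pq p∣q
... | inj₁ p≡1 = contradiction p≡1 (prime⇒≢1 pp)
... | inj₂ p≡q = p≡q

prime∣m^e⇒prime∣m : ∀ {p m} e → Prime p → p ∣ m ^ e → p ∣ m
prime∣m^e⇒prime∣m zero pp p∣1 = contradiction (∣1⇒≡1 p∣1) (prime⇒≢1 pp)
prime∣m^e⇒prime∣m {m = m} (suc e) pp p∣m^1+e with euclidsLemma m (m ^ e) pp p∣m^1+e
... | inj₁ p∣m   = p∣m
... | inj₂ p∣m^e = prime∣m^e⇒prime∣m e pp p∣m^e

∣m∸n∣m⇒∣n : ∀ {d m n} → n ≤ m → d ∣ m ∸ n → d ∣ m → d ∣ n
∣m∸n∣m⇒∣n {d} n≤m d∣m∸n d∣m =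
  ∣m+n∣m⇒∣n (subst (d ∣_) (sym (m∸n+n≡m n≤m)) d∣m) d∣m∸n

product≡^length : ∀ {v} as → All Prime as →
  (∀ {p} → Prime p → p ∣ product as → p ≡ v) → product as ≡ v ^ length as
product≡^length []       []         onlyV = refl
product≡^length (a ∷ as) (pa ∷ pas) onlyV =
  cong₂ _*_ (onlyV pa (m∣m*n (product as)))
            (product≡^length as pas (λ pp p∣as → onlyV pp (∣n⇒∣m*n a p∣as)))

1<m^e⇒1≤e : ∀ {m} e → 1 < m ^ e → 1 ≤ e
1<m^e⇒1≤e zero    1<1 = contradiction 1<1 (<-irrefl refl)
1<m^e⇒1≤e (suc e) _   = s≤s z≤n

onlyPrimeDivisor⇒power : ∀ {m v} → 1 < m →
  (∀ {p} → Prime p → p ∣ m → p ≡ v) → ∃[ e ] (1 ≤ e × v ^ e ≡ m)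
onlyPrimeDivisor⇒power {m} {v} 1<m onlyV =
  length factors , 1<m^e⇒1≤e (length factors) (subst (1 <_) m≡v^e 1<m) , sym m≡v^e
  where
  open PrimeFactorisation (factorise m {{>-nonZero (<⇒≤ 1<m)}})
  m≡v^e : m ≡ v ^ length factors
  m≡v^e = trans isFactorisation (product≡^length factors factorsPrime
    (λ pp p∣product → onlyV pp (subst (_ ∣_) (sym isFactorisation) p∣product)))

vertex⇒≤ : ∀ {n u} → IsVertex n u → u ≤ n
vertex⇒≤ {n} (_ , _ , u≤n∸2) = ≤-trans u≤n∸2 (m∸n≤m n 2)

vertex⇒2≤n∸v : ∀ {n v} → IsVertex n v → 2 ≤ n ∸ v
vertex⇒2≤n∸v {n} {v} vertex@(_ , 2≤v , v≤n∸2) =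
  subst (_≤ n ∸ v) (m∸[m∸n]≡n {n} (≤-trans 2≤v (vertex⇒≤ vertex))) (∸-monoʳ-≤ n v≤n∸2)

primeDivisor⇒arc : ∀ {n v p} → IsVertex n v → Prime p → p ∣ n ∸ v → IsArc n p v
primeDivisor⇒arc {n} {v} {p} vertex@(_ , 2≤v , _) pp p∣n∸v =
  (pp , prime⇒2≤ pp , p≤n∸2) , vertex , p∣n∸v
  where
  p≤n∸2 : p ≤ n ∸ 2
  p≤n∸2 = ≤-trans (∣⇒≤ {{>-nonZero (<⇒≤ (vertex⇒2≤n∸v vertex))}} p∣n∸v) (∸-monoʳ-≤ n 2≤v)

isolated⇒onlyPrimeDivisor : ∀ {n v p} → IsVertex n v → Isolated n v →
  Prime p → p ∣ n ∸ v → p ≡ v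
isolated⇒onlyPrimeDivisor {v = v} {p} vertex isolated pp p∣n∸v with p ≟ v
... | yes p≡v = p≡v
... | no  p≢v = contradiction (primeDivisor⇒arc vertex pp p∣n∸v) (proj₁ (isolated p p≢v))

power⇒arcInto≡ : ∀ {n u v} e → v ^ e ≡ n ∸ v → IsArc n u v → u ≡ v
power⇒arcInto≡ e v^e≡n∸v ((pu , _) , (pv , _) , u∣n∸v) =
  prime∣prime⇒≡ pu pv (prime∣m^e⇒prime∣m e pu (subst (_ ∣_) (sym v^e≡n∸v) u∣n∸v))

power⇒arcOutOf≡ : ∀ {n u v e} → 1 ≤ e → v ^ e ≡ n ∸ v → IsArc n v u → v ≡ u
power⇒arcOutOf≡ {n} {v = v} {suc e} _ v^e≡n∸v (vertexV@(pv , _) , vertexU@(pu , _) , v∣n∸u) =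
  prime∣prime⇒≡ pv pu (∣m∸n∣m⇒∣n (vertex⇒≤ vertexU) v∣n∸u v∣n)
  where
  v∣n : v ∣ n
  v∣n = ∣m∸n∣n⇒∣m v (vertex⇒≤ vertexV) (subst (v ∣_) v^e≡n∸v (m∣m*n (v ^ e))) ∣-refl

mainTheorem13 : (n : ℕ) → 4 ≤ n → 2 ∣ n → (v : ℕ) → IsVertex n v →
    (Isolated n v ⇔ (∃[ e ] (1 ≤ e × v ^ e ≡ n ∸ v)))
mainTheorem13 n _ _ v vertex = mk⇔ isolated⇒power power⇒isolated
  where
  isolated⇒power : Isolated n v → ∃[ e ] (1 ≤ e × v ^ e ≡ n ∸ v)
  isolated⇒power isolated =
    onlyPrimeDivisor⇒power (vertex⇒2≤n∸v vertex) (isolated⇒onlyPrimeDivisor vertex isolated)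

  power⇒isolated : ∃[ e ] (1 ≤ e × v ^ e ≡ n ∸ v) → Isolated n v
  power⇒isolated (e , 1≤e , v^e≡n∸v) u u≢v =
    (λ arcInto  → u≢v (power⇒arcInto≡ e v^e≡n∸v arcInto)) ,
    (λ arcOutOf → u≢v (sym (power⇒arcOutOf≡ 1≤e v^e≡n∸v arcOutOf)))
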